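{- Let $k\ge2$ and $0\le q\le k-2$ be integers, and let $\lambda=M^{k-1}+\epsilon$ be a mancala configuration where $\epsilon:\mathbb N^*\to\mathbb N$ satisfies $\epsilon_i\in\{1,2\}$ for $1\le i<k-q-1$, $\epsilon_{k-q-1}=2$, $\epsilon_i=1$ for $k-q\le i<k$, and $\epsilon_i=0$ for $i\ge k$ (a $q$-biaugmented marching group of the second kind). Then the depth of $\lambda$ is $(q+1)k$, i.e. $\Phi^t(\lambda)$ is an augmented marching group for $t=(q+1)k$ and for no smaller $t\ge0$.
   Context: A mancala configuration is $\lambda:\mathbb N^*\to\mathbb N$ whose support is $\{1,\dots,\ell\}$ for some $\ell\ge0$. Move $\Phi$: $\mu=\Phi(\lambda)$ with $\mu_i=\lambda_{i+1}+1$ for $1\le i\le\lambda_1$ and $\mu_i=\lambda_{i+1}$ for $i>\lambda_1$; $\Phi^t$ its iterate. Order is componentwise; $\lambda<\mu$ means $\lambda\le\mu$ and $\lambda\ne\mu$. Marching group $M^j$: $M^j_i=j-i+1$ for $i\le j$, $0$ otherwise. An augmented marching group is a mancala configuration $\lambda$ with $M^j\le\lambda<M^{j+1}$ for some $j\ge0$. The depth of $\lambda$ is the least $t\ge0$ with $\Phi^t(\lambda)$ an augmented marching group. -}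

module Defs where

open import Data.Nat using (ℕ; zero; suc; _+_; _*_; _∸_; _≤_; _<_; _≤ᵇ_)
open import Data.Bool using (if_then_else_)
open import Data.Product using (_×_; ∃-syntax)
open import Relation.Nullary using (¬_)
open import Relation.Binary.PropositionalEquality using (_≡_)
open import Function.Bundles using (_⇔_)

-- A configuration is a function ℕ → ℕ; only positions i ≥ 1 are meaningful
-- (λ i is λ_i for i ∈ ℕ* = {1,2,...}); the value at index 0 is ignored
-- by every notion below.
Config : Set
Config = ℕ → ℕ

IsMancala : Config → Set
IsMancala λ' = ∃[ ℓ ] (∀ i → 1 ≤ i → ((0 < λ' i) ⇔ (i ≤ ℓ)))

Φ : Config → Config
Φ λ' zero = 0
Φ λ' (suc i) = λ' (suc (suc i)) + (if suc i ≤ᵇ λ' 1 then 1 else 0)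

Φ^ : ℕ → Config → Config
Φ^ zero λ' = λ'
Φ^ (suc t) λ' = Φ (Φ^ t λ')

_≼_ : Config → Config → Set
λ' ≼ μ = ∀ i → 1 ≤ i → λ' i ≤ μ i

_≺_ : Config → Config → Set
λ' ≺ μ = (λ' ≼ μ) × ¬ (∀ i → 1 ≤ i → λ' i ≡ μ i)

M : ℕ → Config
M j zero = 0
M j (suc i) = suc j ∸ suc i

IsAugmentedMarchingGroup : Config → Set
IsAugmentedMarchingGroup λ' =
  IsMancala λ' × ∃[ j ] ((M j ≼ λ') × (λ' ≺ M (suc j)))

HasDepth : Config → ℕ → Set
HasDepth λ' d = IsAugmentedMarchingGroup (Φ^ d λ')
              × (∀ t → t < d → ¬ IsAugmentedMarchingGroup (Φ^ t λ'))

_⊕_ : Config → Config → Config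
(f ⊕ g) i = f i + g i

module Submission where

-- Let k = d + q + 2, so that the forced 2 of ε sits at d + 1, and write Φ^t(λ) = M^m + e_t
-- with m = k - 1. A move shifts the excess left and lets the first pile overflow past
-- position m: e_{t+1} gets an extra ⟦1 ≤ e_t(1)⟧ at position m+1 and ⟦2 ≤ e_t(1)⟧ at m+2.
-- So the orbit is encoded by the single sequence x of first entries: e_t carries
-- x(t+1), …, x(t+k) at positions 1 … k and the carry ⟦2 ≤ x t⟧ at k+1, and
-- x(t+1+k) = ⟦1 ≤ x(t+1)⟧ + ⟦2 ≤ x t⟧. Cut x into rows of length k, row 0 being 0, ε_1 … ε_m.
-- Row r+1 is row r shifted one step to the right with a 1 inserted after its leading 0, so
-- the 2 of ε travels along (d+1) + r(k+1), and the rows keep starting with 0 until the 2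
-- reaches the end of row q, which makes row q+2 start with 1. Every window before time
-- (q+1)k thus meets a 0, where Φ^t(λ) agrees with M^m, and a 2, where it exceeds M^{m+1}.
-- At time (q+1)k the window is the rest of row q+1 and the 1 starting row q+2, all in
-- {1, 2}, and the carry is 0: then M^k ≤ Φ^t(λ) < M^{k+1}.

open import Defs
open import Data.Nat using (ℕ; zero; suc; _+_; _*_; _∸_; _≤_; _<_; z≤n; s≤s; z<s; _≤ᵇ_; _≤?_; _<?_)
open import Data.Nat.Properties
open import Data.Nat.Tactic.RingSolver using (solve-∀)
open import Data.Bool using (true; false; if_then_else_; T)
open import Data.Bool.Properties using (T-≡)
open import Data.Product using (_×_; _,_; proj₁; proj₂; ∃-syntax)
open import Data.Sum using (_⊎_; inj₁; inj₂)
open import Function.Bundles using (_⇔_; mk⇔; Equivalence)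
open import Relation.Nullary using (¬_; yes; no; contradiction)
open import Relation.Binary.PropositionalEquality
open import Relation.Binary.Definitions using (tri<; tri≈; tri>)

⟦_≤_⟧ : ℕ → ℕ → ℕ
⟦ j ≤ a ⟧ = if j ≤ᵇ a then 1 else 0

≤ᵇ-true : ∀ {j a} → j ≤ a → (j ≤ᵇ a) ≡ true
≤ᵇ-true j≤a = Equivalence.to T-≡ (≤⇒≤ᵇ j≤a)

≤ᵇ-false : ∀ {j a} → a < j → (j ≤ᵇ a) ≡ false
≤ᵇ-false {j} {a} a<j with j ≤ᵇ a in eq
... | false = refl
... | true = contradiction (≤ᵇ⇒≤ j a (subst T (sym eq) _)) (<⇒≱ a<j)

⟦≤⟧-true : ∀ {j a} → j ≤ a → ⟦ j ≤ a ⟧ ≡ 1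
⟦≤⟧-true j≤a rewrite ≤ᵇ-true j≤a = refl

⟦≤⟧-false : ∀ {j a} → a < j → ⟦ j ≤ a ⟧ ≡ 0
⟦≤⟧-false a<j rewrite ≤ᵇ-false a<j = refl

⟦suc≤suc⟧ : ∀ j a → ⟦ suc j ≤ suc a ⟧ ≡ ⟦ j ≤ a ⟧
⟦suc≤suc⟧ zero a = refl
⟦suc≤suc⟧ (suc j) a = refl

⟦+≤+⟧ : ∀ m j a → ⟦ m + j ≤ m + a ⟧ ≡ ⟦ j ≤ a ⟧
⟦+≤+⟧ zero j a = refl
⟦+≤+⟧ (suc m) j a = trans (⟦suc≤suc⟧ (m + j) (m + a)) (⟦+≤+⟧ m j a)

⟦≤⟧≤1 : ∀ j a → ⟦ j ≤ a ⟧ ≤ 1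
⟦≤⟧≤1 j a with j ≤ᵇ a
... | true = ≤-refl
... | false = z≤n

one-or-two⇒between : ∀ {n} → n ≡ 1 ⊎ n ≡ 2 → 1 ≤ n × n ≤ 2
one-or-two⇒between (inj₁ refl) = ≤-refl , s≤s z≤n
one-or-two⇒between (inj₂ refl) = s≤s z≤n , ≤-refl

_≈⁺_ : Config → Config → Set
f ≈⁺ g = ∀ i → f (suc i) ≡ g (suc i)

Φ-cong : ∀ {f g} → f ≈⁺ g → Φ f ≈⁺ Φ g
Φ-cong {f} {g} f≈g i rewrite f≈g 0 | f≈g (suc i) = refl

IsAugmentedMarchingGroup-resp : ∀ {f g} → f ≈⁺ g →
  IsAugmentedMarchingGroup g → IsAugmentedMarchingGroup f
IsAugmentedMarchingGroup-resp {f} {g} f≈g ((ℓ , support) , j , lower , upper , g≢) =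
  (ℓ , support′) , j , lower′ , upper′ , f≢
  where
  support′ : ∀ i → 1 ≤ i → (0 < f i) ⇔ (i ≤ ℓ)
  support′ (suc i) rewrite f≈g i = support (suc i)
  lower′ : M j ≼ f
  lower′ (suc i) rewrite f≈g i = lower (suc i)
  upper′ : f ≼ M (suc j)
  upper′ (suc i) rewrite f≈g i = upper (suc i)
  f≢ : ¬ (∀ i → 1 ≤ i → f i ≡ M (suc j) i)
  f≢ f≡ = g≢ λ { (suc i) 1≤i → trans (sym (f≈g i)) (f≡ (suc i) 1≤i) }

M-mono : ∀ {j j′} → j ≤ j′ → M j ≼ M j′
M-mono j≤j′ (suc i) _ = ∸-monoˡ-≤ i j≤j′

M-index-≤ : ∀ {j m i λ′} → M j ≼ λ′ → i ≤ m → λ′ (suc i) ≤ M m (suc i) → j ≤ m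
M-index-≤ {j} {m} {i} lower i≤m λ≤M = begin
  j             ≤⟨ m≤n+m∸n j i ⟩
  i + (j ∸ i)   ≤⟨ +-monoʳ-≤ i (≤-trans (lower (suc i) (s≤s z≤n)) λ≤M) ⟩
  i + (m ∸ i)   ≡⟨ m+[n∸m]≡n i≤m ⟩
  m             ∎
  where open ≤-Reasoning

¬IsAugmentedMarchingGroup : ∀ {λ′} m i w → i ≤ m → λ′ (suc i) ≤ M m (suc i) →
  M (suc m) (suc w) < λ′ (suc w) → ¬ IsAugmentedMarchingGroup λ′
¬IsAugmentedMarchingGroup m i w i≤m touch exceed (_ , j , lower , upper , _) =
  <⇒≱ exceed (≤-trans (upper (suc w) (s≤s z≤n))
                      (M-mono (s≤s (M-index-≤ lower i≤m touch)) (suc w) (s≤s z≤n)))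

IsAugmentedMarchingGroup-M⊕ : ∀ m e → (∀ i → i ≤ m → 1 ≤ e (suc i) × e (suc i) ≤ 2) →
  (∀ i → m < i → e (suc i) ≡ 0) → IsAugmentedMarchingGroup (M m ⊕ e)
IsAugmentedMarchingGroup-M⊕ m e bounds vanish =
  (suc m , support) , suc m , lower , upper , differs
  where
  beyond : ∀ {i} → m < i → (M m ⊕ e) (suc i) ≡ 0
  beyond {i} m<i rewrite m≤n⇒m∸n≡0 (<⇒≤ m<i) = vanish i m<i
  support : ∀ i → 1 ≤ i → (0 < (M m ⊕ e) i) ⇔ (i ≤ suc m)
  support (suc i) _ with i ≤? m
  ... | yes i≤m = mk⇔ (λ _ → s≤s i≤m) (λ _ → ≤-trans (proj₁ (bounds i i≤m)) (m≤n+m _ (m ∸ i)))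
  ... | no i≰m = mk⇔ (λ pos → contradiction (beyond (≰⇒> i≰m)) (>⇒≢ pos))
                     (λ i≤m → contradiction (≤-pred i≤m) i≰m)
  lower : M (suc m) ≼ (M m ⊕ e)
  lower (suc i) _ with i ≤? m
  ... | yes i≤m = begin
    suc m ∸ i          ≡⟨ +-∸-assoc 1 i≤m ⟩
    1 + (m ∸ i)        ≤⟨ +-monoˡ-≤ (m ∸ i) (proj₁ (bounds i i≤m)) ⟩
    e (suc i) + (m ∸ i) ≡⟨ +-comm (e (suc i)) (m ∸ i) ⟩
    (m ∸ i) + e (suc i) ∎
    where open ≤-Reasoning
  ... | no i≰m rewrite m≤n⇒m∸n≡0 (≰⇒> i≰m) = z≤n
  upper : (M m ⊕ e) ≼ M (suc (suc m))
  upper (suc i) _ with i ≤? m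
  ... | yes i≤m = begin
    (m ∸ i) + e (suc i) ≤⟨ +-monoʳ-≤ (m ∸ i) (proj₂ (bounds i i≤m)) ⟩
    (m ∸ i) + 2         ≡⟨ +-comm (m ∸ i) 2 ⟩
    2 + (m ∸ i)         ≡⟨ +-∸-assoc 2 i≤m ⟨
    suc (suc m) ∸ i     ∎
    where open ≤-Reasoning
  ... | no i≰m rewrite beyond (≰⇒> i≰m) = z≤n
  differs : ¬ (∀ i → 1 ≤ i → (M m ⊕ e) i ≡ M (suc (suc m)) i)
  differs agree = 0≢1+n (trans (sym (beyond ≤-refl))
                               (trans (agree (suc (suc m)) (s≤s z≤n)) (m+n∸n≡m 1 m)))

progression-meets : ∀ a L R t → a ≤ t + L → t ≤ a + R * suc L →
  ∃[ r ] r ≤ R × t ≤ a + r * suc L × a + r * suc L ≤ t + L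
progression-meets a L zero t a≤t+L t≤a+0 =
  0 , z≤n , t≤a+0 , ≤-trans (≤-reflexive (+-identityʳ a)) a≤t+L
progression-meets a L (suc R) t a≤t+L t≤last with t ≤? a + R * suc L
... | yes t≤ with progression-meets a L R t a≤t+L t≤
...   | r , r≤R , meets = r , m≤n⇒m≤1+n r≤R , meets
progression-meets a L (suc R) t a≤t+L t≤last | no t≰ = suc R , ≤-refl , t≤last , (begin
  a + suc R * suc L            ≡⟨ rearrange a L R ⟩
  suc (a + R * suc L) + L      ≤⟨ +-monoˡ-≤ L (≰⇒> t≰) ⟩
  t + L                        ∎)
  where
  open ≤-Reasoning
  rearrange : ∀ a L R → a + suc R * suc L ≡ suc (a + R * suc L) + L
  rearrange = solve-∀

progression-hits : ∀ a L R t → a ≤ t + L → t ≤ a + R * suc L →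
  ∃[ r ] ∃[ i ] r ≤ R × i ≤ L × t + i ≡ a + r * suc L
progression-hits a L R t a≤t+L t≤last with progression-meets a L R t a≤t+L t≤last
... | r , r≤R , t≤s , s≤t+L = r , (a + r * suc L) ∸ t , r≤R , m≤n+o⇒m∸n≤o _ t s≤t+L , m+[n∸m]≡n t≤s

-- The next excess over M m: shifted left, plus the part of the sown first pile that overflows past position m.
σ : ℕ → Config → Config
σ m e zero = 0
σ m e (suc i) = e (suc (suc i)) + (if suc i ≤ᵇ m then 0 else ⟦ suc i ≤ m + e 1 ⟧)

Φ-M⊕ : ∀ m e → Φ (M m ⊕ e) ≈⁺ (M m ⊕ σ m e)
Φ-M⊕ m e i with i <? m
... | yes i<m rewrite ≤ᵇ-true i<m | ⟦≤⟧-true (≤-trans i<m (m≤m+n m (e 1))) = begin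
  (m ∸ suc i + e″) + 1   ≡⟨ +-comm _ 1 ⟩
  suc (m ∸ suc i) + e″   ≡⟨ cong (_+ e″) (+-∸-assoc 1 i<m) ⟨
  (m ∸ i) + e″           ≡⟨ cong ((m ∸ i) +_) (+-identityʳ e″) ⟨
  (m ∸ i) + (e″ + 0)     ∎
  where
  e″ : ℕ
  e″ = e (suc (suc i))
  open ≡-Reasoning
... | no i≮m rewrite ≤ᵇ-false (s≤s (≮⇒≥ i≮m)) | m≤n⇒m∸n≡0 (≮⇒≥ i≮m)
                    | m≤n⇒m∸n≡0 (m≤n⇒m≤1+n (≮⇒≥ i≮m)) = refl

σ-shift : ∀ {m i} e → i < m → σ m e (suc i) ≡ e (suc (suc i))
σ-shift {i = i} e i<m rewrite ≤ᵇ-true i<m = +-identityʳ (e (suc (suc i)))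

σ-overflow : ∀ m e j → σ m e (suc (j + m)) ≡ e (suc (suc (j + m))) + ⟦ suc j ≤ e 1 ⟧
σ-overflow m e j rewrite ≤ᵇ-false (s≤s (m≤n+m m j)) =
  cong (e (suc (suc (j + m))) +_) (trans (cong ⟦_≤ m + e 1 ⟧ (+-comm (suc j) m)) (⟦+≤+⟧ m (suc j) (e 1)))

record SmallExcess (m : ℕ) (e : Config) : Set where
  field
    entry≤2 : ∀ i → e (suc i) ≤ 2
    carry≤1 : e (suc (suc m)) ≤ 1
    vanish  : ∀ j → e (suc (suc (suc (j + m)))) ≡ 0

module _ {m e} (small : SmallExcess m e) where
  open SmallExcess small

  σ-carry : σ m e (suc (suc m)) ≡ ⟦ 2 ≤ e 1 ⟧
  σ-carry = trans (σ-overflow m e 1) (cong (_+ ⟦ 2 ≤ e 1 ⟧) (vanish 0))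

  σ-vanish : ∀ j → σ m e (suc (suc (suc (j + m)))) ≡ 0
  σ-vanish j = begin
    σ m e (suc (suc (suc (j + m))))          ≡⟨ σ-overflow m e (suc (suc j)) ⟩
    e (suc (suc (suc (suc (j + m))))) + ⟦ 3 + j ≤ e 1 ⟧
                                             ≡⟨ cong₂ _+_ (vanish (suc j)) (⟦≤⟧-false (s≤s (≤-trans (entry≤2 0) (m≤m+n 2 j)))) ⟩
    0                                        ∎
    where open ≡-Reasoning

  σ-small : SmallExcess m (σ m e)
  σ-small = record { entry≤2 = entry≤2′ ; carry≤1 = carry≤1′ ; vanish = σ-vanish }
    where
    carry≤1′ : σ m e (suc (suc m)) ≤ 1
    carry≤1′ rewrite σ-carry = ⟦≤⟧≤1 2 (e 1)
    overflow≤2 : ∀ j → σ m e (suc (j + m)) ≤ 2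
    overflow≤2 zero rewrite σ-overflow m e 0 = +-mono-≤ carry≤1 (⟦≤⟧≤1 1 (e 1))
    overflow≤2 (suc zero) = ≤-trans carry≤1′ (n≤1+n 1)
    overflow≤2 (suc (suc j)) rewrite σ-vanish j = z≤n
    entry≤2′ : ∀ i → σ m e (suc i) ≤ 2
    entry≤2′ i with i <? m
    ... | yes i<m rewrite σ-shift e i<m = entry≤2 (suc i)
    ... | no i≮m = subst (λ n → σ m e (suc n) ≤ 2) (m∸n+n≡m (≮⇒≥ i≮m)) (overflow≤2 (i ∸ m))

module Orbit (m : ℕ) (e : Config) (small : SmallExcess m e) (no-carry : e (suc (suc m)) ≡ 0) where

  orbit : ℕ → Config
  orbit zero = e
  orbit (suc t) = σ m (orbit t)

  Φ^-M⊕ : ∀ t → Φ^ t (M m ⊕ e) ≈⁺ (M m ⊕ orbit t)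
  Φ^-M⊕ zero i = refl
  Φ^-M⊕ (suc t) i = trans (Φ-cong {Φ^ t (M m ⊕ e)} {M m ⊕ orbit t} (Φ^-M⊕ t) i) (Φ-M⊕ m (orbit t) i)

  orbit-small : ∀ t → SmallExcess m (orbit t)
  orbit-small zero = small
  orbit-small (suc t) = σ-small (orbit-small t)

  -- x 0 = 0 plays the first entry before time 0, which makes orbit-carry uniform in t.
  x : ℕ → ℕ
  x zero = 0
  x (suc t) = orbit t 1

  x≤2 : ∀ t → x t ≤ 2
  x≤2 zero = z≤n
  x≤2 (suc t) = SmallExcess.entry≤2 (orbit-small t) 0

  orbit-front : ∀ t i → i ≤ m → orbit t (suc i) ≡ x (t + suc i)
  orbit-front t zero _ = cong x (+-comm 1 t)
  orbit-front t (suc i) i<m = begin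
    orbit t (suc (suc i))   ≡⟨ σ-shift (orbit t) i<m ⟨
    orbit (suc t) (suc i)   ≡⟨ orbit-front (suc t) i (<⇒≤ i<m) ⟩
    x (suc t + suc i)       ≡⟨ cong x (+-suc t (suc i)) ⟨
    x (t + suc (suc i))     ∎
    where open ≡-Reasoning

  orbit-carry : ∀ t → orbit t (suc (suc m)) ≡ ⟦ 2 ≤ x t ⟧
  orbit-carry zero = no-carry
  orbit-carry (suc t) = σ-carry (orbit-small t)

  orbit-vanish : ∀ t j → orbit t (suc (suc (suc (j + m)))) ≡ 0
  orbit-vanish t = SmallExcess.vanish (orbit-small t)

  x-rec : ∀ t → x (suc t + suc m) ≡ ⟦ 1 ≤ x (suc t) ⟧ + ⟦ 2 ≤ x t ⟧
  x-rec t = begin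
    x (suc t + suc m)                                  ≡⟨ orbit-front (suc t) m ≤-refl ⟨
    σ m (orbit t) (suc m)                              ≡⟨ σ-overflow m (orbit t) 0 ⟩
    orbit t (suc (suc m)) + ⟦ 1 ≤ x (suc t) ⟧          ≡⟨ cong (_+ ⟦ 1 ≤ x (suc t) ⟧) (orbit-carry t) ⟩
    ⟦ 2 ≤ x t ⟧ + ⟦ 1 ≤ x (suc t) ⟧                    ≡⟨ +-comm ⟦ 2 ≤ x t ⟧ _ ⟩
    ⟦ 1 ≤ x (suc t) ⟧ + ⟦ 2 ≤ x t ⟧                    ∎
    where open ≡-Reasoning

  orbit-beyond : ∀ t → x t < 2 → ∀ i → m < i → orbit t (suc i) ≡ 0
  orbit-beyond t x<2 i m<i =
    subst (λ n → orbit t (suc n) ≡ 0) (trans (sym (+-suc (i ∸ suc m) m)) (m∸n+n≡m m<i)) (beyond (i ∸ suc m))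
    where
    beyond : ∀ j → orbit t (suc (suc (j + m))) ≡ 0
    beyond zero = trans (orbit-carry t) (⟦≤⟧-false x<2)
    beyond (suc j) = orbit-vanish t j

  x-window : ∀ t i → i ≤ m → Φ^ t (M m ⊕ e) (suc i) ≡ (m ∸ i) + x (t + suc i)
  x-window t i i≤m = trans (Φ^-M⊕ t i) (cong ((m ∸ i) +_) (orbit-front t i i≤m))

  -- w = 0 is a 2 just before the window, acting through the carry at position m + 2.
  ¬IsAugmentedMarchingGroup-Φ^ : ∀ t i w → i ≤ m → x (t + suc i) ≡ 0 → w ≤ suc m → x (t + w) ≡ 2 →
    ¬ IsAugmentedMarchingGroup (Φ^ t (M m ⊕ e))
  ¬IsAugmentedMarchingGroup-Φ^ t i w i≤m zero-at w≤1+m two-at =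
    ¬IsAugmentedMarchingGroup m i (proj₁ witness) i≤m touch (proj₂ witness)
    where
    λₜ : Config
    λₜ = Φ^ t (M m ⊕ e)
    touch : λₜ (suc i) ≤ M m (suc i)
    touch rewrite x-window t i i≤m | zero-at = ≤-reflexive (+-identityʳ (m ∸ i))
    exceed : ∀ w → w ≤ suc m → x (t + w) ≡ 2 → ∃[ v ] M (suc m) (suc v) < λₜ (suc v)
    exceed zero _ two-at = suc m , subst₂ _<_ (sym (n∸n≡0 m)) (sym carry) ≤-refl
      where
      carry : λₜ (suc (suc m)) ≡ 1
      carry rewrite Φ^-M⊕ t (suc m) | m≤n⇒m∸n≡0 (n≤1+n m) | orbit-carry t
                  | trans (cong x (sym (+-identityʳ t))) two-at = refl
    exceed (suc v) v<1+m two-at = v , subst₂ _<_ (sym (+-∸-assoc 1 v≤m)) (sym (x-window t v v≤m)) above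
      where
      v≤m : v ≤ m
      v≤m = ≤-pred v<1+m
      above : suc (m ∸ v) < (m ∸ v) + x (t + suc v)
      above rewrite two-at | +-comm (m ∸ v) 2 = ≤-refl
    witness : ∃[ v ] M (suc m) (suc v) < λₜ (suc v)
    witness = exceed w w≤1+m two-at

  IsAugmentedMarchingGroup-Φ^ : ∀ t → x t ≡ 0 → (∀ i → i ≤ m → 1 ≤ x (t + suc i)) →
    IsAugmentedMarchingGroup (Φ^ t (M m ⊕ e))
  IsAugmentedMarchingGroup-Φ^ t zero-at positive = IsAugmentedMarchingGroup-resp (Φ^-M⊕ t)
    (IsAugmentedMarchingGroup-M⊕ m (orbit t) bounds (orbit-beyond t (subst (_< 2) (sym zero-at) z<s)))
    where
    bounds : ∀ i → i ≤ m → 1 ≤ orbit t (suc i) × orbit t (suc i) ≤ 2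
    bounds i i≤m rewrite orbit-front t i i≤m = positive i i≤m , x≤2 (t + suc i)

module Biaugmented (d q : ℕ) (ε : Config)
  (ε-free : ∀ i → 1 ≤ i → i ≤ d → ε i ≡ 1 ⊎ ε i ≡ 2)
  (ε-two  : ε (suc d) ≡ 2)
  (ε-one  : ∀ i → suc d < i → i ≤ suc (d + q) → ε i ≡ 1)
  (ε-zero : ∀ i → suc (d + q) < i → ε i ≡ 0) where

  m : ℕ
  m = suc (d + q)

  k : ℕ
  k = suc m

  ε-between : ∀ i → 1 ≤ i → i ≤ m → 1 ≤ ε i × ε i ≤ 2
  ε-between i 1≤i i≤m with <-cmp i (suc d)
  ... | tri< i<1+d _ _ = one-or-two⇒between (ε-free i 1≤i (≤-pred i<1+d))
  ... | tri≈ _ refl _ = one-or-two⇒between (inj₂ ε-two)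
  ... | tri> _ _ 1+d<i = one-or-two⇒between (inj₁ (ε-one i 1+d<i i≤m))

  ε-small : SmallExcess m ε
  ε-small = record
    { entry≤2 = entry≤2
    ; carry≤1 = subst (_≤ 1) (sym (ε-zero (suc (suc m)) (s≤s (n≤1+n m)))) z≤n
    ; vanish  = λ j → ε-zero _ (s≤s (≤-trans (n≤1+n m) (s≤s (m≤n+m m (suc j)))))
    }
    where
    entry≤2 : ∀ i → ε (suc i) ≤ 2
    entry≤2 i with suc i ≤? m
    ... | yes i<m = proj₂ (ε-between (suc i) (s≤s z≤n) i<m)
    ... | no i≮m rewrite ε-zero (suc i) (≰⇒> i≮m) = z≤n

  open Orbit m ε ε-small (ε-zero (suc (suc m)) (s≤s (n≤1+n m)))

  x-init : ∀ i → i ≤ m → x (suc i) ≡ ε (suc i)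
  x-init i i≤m = sym (orbit-front 0 i i≤m)

  x-next-row : ∀ r p → x (suc r * k + suc p) ≡ ⟦ 1 ≤ x (r * k + suc p) ⟧ + ⟦ 2 ≤ x (r * k + p) ⟧
  x-next-row r p = begin
    x (suc r * k + suc p)                               ≡⟨ cong x (index r p m) ⟩
    x (suc (r * k + p) + k)                             ≡⟨ x-rec (r * k + p) ⟩
    ⟦ 1 ≤ x (suc (r * k + p)) ⟧ + ⟦ 2 ≤ x (r * k + p) ⟧ ≡⟨ cong (λ n → ⟦ 1 ≤ x n ⟧ + ⟦ 2 ≤ x (r * k + p) ⟧) (+-suc (r * k) p) ⟨
    ⟦ 1 ≤ x (r * k + suc p) ⟧ + ⟦ 2 ≤ x (r * k + p) ⟧   ∎
    where
    open ≡-Reasoning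
    index : ∀ r p m → suc r * suc m + suc p ≡ suc (r * suc m + p) + suc m
    index = solve-∀

  x-row-start : ∀ r → x (suc (suc r) * k) ≡ ⟦ 1 ≤ x (suc r * k) ⟧ + ⟦ 2 ≤ x (r * k + m) ⟧
  x-row-start r = begin
    x (suc (suc r) * k)                                  ≡⟨ cong x (index₁ r m) ⟩
    x (suc (r * k + m) + k)                              ≡⟨ x-rec (r * k + m) ⟩
    ⟦ 1 ≤ x (suc (r * k + m)) ⟧ + ⟦ 2 ≤ x (r * k + m) ⟧  ≡⟨ cong (λ n → ⟦ 1 ≤ x n ⟧ + ⟦ 2 ≤ x (r * k + m) ⟧) (index₂ r m) ⟩
    ⟦ 1 ≤ x (suc r * k) ⟧ + ⟦ 2 ≤ x (r * k + m) ⟧        ∎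
    where
    open ≡-Reasoning
    index₁ : ∀ r m → suc (suc r) * suc m ≡ suc (r * suc m + m) + suc m
    index₁ = solve-∀
    index₂ : ∀ r m → suc (r * suc m + m) ≡ suc r * suc m
    index₂ = solve-∀

  x-positive : ∀ r p → 1 ≤ p → p ≤ m → 1 ≤ x (r * k + p)
  x-positive zero (suc p) _ p<m rewrite x-init p (<⇒≤ p<m) = proj₁ (ε-between (suc p) (s≤s z≤n) p<m)
  x-positive (suc r) (suc p) _ p<m rewrite x-next-row r p | ⟦≤⟧-true (x-positive r (suc p) (s≤s z≤n) p<m) = s≤s z≤n

  x-ones : ∀ r p → r + suc d < p → p ≤ m → x (r * k + p) ≡ 1
  x-ones zero (suc p) 1+d<p p<m rewrite x-init p (<⇒≤ p<m) = ε-one (suc p) 1+d<p p<m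
  x-ones (suc r) (suc p) (s≤s r+1+d<p) p<m
    rewrite x-next-row r p | ⟦≤⟧-true (x-positive r (suc p) (s≤s z≤n) p<m) | x-ones r p r+1+d<p (<⇒≤ p<m) = refl

  diagonal<m : ∀ {r} → r < q → r + suc d < m
  diagonal<m {r} r<q = s≤s (begin
    r + suc d   ≡⟨ +-suc r d ⟩
    suc r + d   ≤⟨ +-monoˡ-≤ d r<q ⟩
    q + d       ≡⟨ +-comm q d ⟩
    d + q       ∎)
    where open ≤-Reasoning

  diagonal-end : q + suc d ≡ m
  diagonal-end = trans (+-suc q d) (cong suc (+-comm q d))

  x-twos : ∀ r → r ≤ q → x (r * k + (r + suc d)) ≡ 2
  x-twos zero _ rewrite x-init d (m≤n⇒m≤1+n (m≤m+n d q)) = ε-two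
  x-twos (suc r) r<q
    rewrite x-next-row r (r + suc d) | ⟦≤⟧-true (x-positive r (suc (r + suc d)) (s≤s z≤n) (diagonal<m r<q))
          | x-twos r (<⇒≤ r<q) = refl

  x-zeros : ∀ r → r ≤ q → x (suc r * k) ≡ 0
  x-zeros zero _ = trans (cong x (+-identityʳ k)) (trans (x-init m ≤-refl) (ε-zero k ≤-refl))
  x-zeros (suc r) r<q rewrite x-row-start r | x-zeros r (<⇒≤ r<q) | x-ones r m (diagonal<m r<q) ≤-refl = refl

  x-row-end : x (suc (suc q) * k) ≡ 1
  x-row-end = trans (x-row-start q) (cong₂ (λ a b → ⟦ 1 ≤ a ⟧ + ⟦ 2 ≤ b ⟧) (x-zeros q ≤-refl) last-two)
    where
    last-two : x (q * k + m) ≡ 2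
    last-two = trans (cong (λ n → x (q * k + n)) (sym diagonal-end)) (x-twos q ≤-refl)

  zero-in-window : ∀ t → t < suc q * k → ∃[ i ] i ≤ m × x (t + suc i) ≡ 0
  zero-in-window t t<end with progression-hits k m q (suc t) (s≤s (m≤n+m m t)) t<end
  ... | r , i , r≤q , i≤m , hit = i , i≤m , trans (cong x (trans (+-suc t i) hit)) (x-zeros r r≤q)

  two-in-window : ∀ t → t < suc q * k → ∃[ w ] w ≤ k × x (t + w) ≡ 2
  two-in-window t t<end with progression-hits (suc d) k q t 1+d≤t+k (≤-pred (subst (t <_) (length d q) t<end))
    where
    length : ∀ d q → suc q * suc (suc (d + q)) ≡ suc (suc d + q * suc (suc (suc (d + q))))
    length = solve-∀
    1+d≤t+k : suc d ≤ t + k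
    1+d≤t+k = ≤-trans (s≤s (m≤n⇒m≤1+n (m≤m+n d q))) (m≤n+m k t)
  ... | r , w , r≤q , w≤k , hit = w , w≤k , trans (cong x (trans hit (index r d m))) (x-twos r r≤q)
    where
    index : ∀ r d m → suc d + r * suc (suc m) ≡ r * suc m + (r + suc d)
    index = solve-∀

  positive-at-end : ∀ i → i ≤ m → 1 ≤ x (suc q * k + suc i)
  positive-at-end i i≤m with m≤n⇒m<n∨m≡n i≤m
  ... | inj₁ i<m = x-positive (suc q) (suc i) (s≤s z≤n) i<m
  ... | inj₂ refl = subst (λ n → 1 ≤ x n) (+-comm k (suc q * k)) (≤-reflexive (sym x-row-end))

  ¬IsAugmentedMarchingGroup-before : ∀ t → t < suc q * k → ¬ IsAugmentedMarchingGroup (Φ^ t (M m ⊕ ε))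
  ¬IsAugmentedMarchingGroup-before t t<end =
    let i , i≤m , zero-at = zero-in-window t t<end
        w , w≤k , two-at  = two-in-window t t<end
    in ¬IsAugmentedMarchingGroup-Φ^ t i w i≤m zero-at w≤k two-at

  depth : HasDepth (M m ⊕ ε) (suc q * k)
  depth = IsAugmentedMarchingGroup-Φ^ (suc q * k) (x-zeros q ≤-refl) positive-at-end , ¬IsAugmentedMarchingGroup-before

mainTheorem7 : (k q : ℕ) → 2 ≤ k → q ≤ k ∸ 2 → (ε : Config) →
    (∀ i → 1 ≤ i → i < k ∸ q ∸ 1 → (ε i ≡ 1 ⊎ ε i ≡ 2)) →
    ε (k ∸ q ∸ 1) ≡ 2 →
    (∀ i → k ∸ q ≤ i → i < k → ε i ≡ 1) →
    (∀ i → k ≤ i → ε i ≡ 0) →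
    IsMancala (M (k ∸ 1) ⊕ ε) →
    HasDepth (M (k ∸ 1) ⊕ ε) (suc q * k)
mainTheorem7 (suc (suc k′)) q _ q≤k′ with k′ ∸ q | m∸n+n≡m q≤k′
... | d | refl rewrite +-∸-assoc 2 (m≤n+m q d) | m+n∸n≡m d q =
  λ ε free two one zero _ → Biaugmented.depth d q ε (λ i 1≤i i≤d → free i 1≤i (s≤s i≤d)) two
                                                     (λ i 1+d<i i≤m → one i 1+d<i (s≤s i≤m)) zero
mainTheorem7 (suc zero) q (s≤s ()) _
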